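{- Let $R$ be a strictly dense set of rooted triples on a finite set $L$ such that $\operatorname{cl}(R')\subseteq R$ for every $R'\subseteq R$ with $|R'|=2$. Let $x\in L$, $L'=L\setminus\{x\}$, and let $R_{|L'}=\{r\in R: L_r\subseteq L'\}$. Then $R_{|L'}$ is strictly dense on $L'$, and $\operatorname{cl}(R')\subseteq R_{|L'}$ holds for every $R'\subseteq R_{|L'}$ with $|R'|=2$.
   Context: A phylogenetic tree on $L$ is a rooted tree with leaf set $L$ and no inner vertex of outdegree one. A rooted triple $(xy|z)$ on distinct leaves has leaf set $L_r=\{x,y,z\}$ and is displayed by a phylogenetic tree $T$ if $\operatorname{lca}_T(x,y)$ is a proper descendant of $\operatorname{lca}_T(x,y,z)$; $\mathfrak{R}(T)$ is the set of triples displayed by $T$. For a triple set $R$, $L_R=\bigcup_{r\in R}L_r$; $R$ is consistent if some phylogenetic tree on $L_R$ displays all of $R$, and then $\operatorname{cl}(R)=\bigcap\mathfrak{R}(T)$ over all phylogenetic trees $T$ on $L_R$ displaying $R$. $R$ is strictly dense on $L$ if for every 3-element subset of $L$ there is exactly one triple in $R$ on those leaves. -}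

module Defs where

open import Level using (0ℓ)
open import Data.Nat using (ℕ; _≤_)
open import Data.List using (List; []; _∷_; _++_; [_]; length)
open import Data.List.Membership.Propositional using (_∈_)
open import Data.List.Relation.Unary.All using (All)
open import Data.List.Relation.Unary.Unique.Propositional using (Unique)
open import Data.Product using (Σ; ∃; _×_; _,_)
open import Data.Sum using (_⊎_)
open import Relation.Nullary using (¬_)
open import Relation.Binary.PropositionalEquality using (_≡_; _≢_)
open import Function.Bundles using (_⇔_)

module _ {A : Set} where

  -- Rooted triples (xy|z) on three distinct leaves.

  record Triple : Set where
    constructor mkTriple
    field
      x y z : A
      x≢y : x ≢ y
      x≢z : x ≢ z
      y≢z : y ≢ z
  open Triple public

  LeafOf : Triple → A → Set
  LeafOf r u = u ≡ x r ⊎ u ≡ y r ⊎ u ≡ z r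

  -- (xy|z) and (yx|z) denote the same triple.
  _≈ₜ_ : Triple → Triple → Set
  r ≈ₜ s = ((x r ≡ x s × y r ≡ y s) ⊎ (x r ≡ y s × y r ≡ x s)) × z r ≡ z s

  TripleSet : Set₁
  TripleSet = Triple → Set

  _∈ₜ_ : Triple → TripleSet → Set
  r ∈ₜ R = Σ Triple λ s → R s × r ≈ₜ s

  _⊆ₜ_ : TripleSet → TripleSet → Set
  R ⊆ₜ S = ∀ r → r ∈ₜ R → r ∈ₜ S

  HasTwoElements : TripleSet → Set
  HasTwoElements R = Σ Triple λ r₁ → Σ Triple λ r₂ →
    ¬ (r₁ ≈ₜ r₂) × (∀ t → (t ∈ₜ R) ⇔ (t ≈ₜ r₁ ⊎ t ≈ₜ r₂))

  LeavesOf : TripleSet → A → Set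
  LeavesOf R u = Σ Triple λ r → r ∈ₜ R × LeafOf r u

  SameLeaves : Triple → A → A → A → Set
  SameLeaves r a b c = ∀ u → LeafOf r u ⇔ (u ≡ a ⊎ u ≡ b ⊎ u ≡ c)

  StrictlyDense : (A → Set) → TripleSet → Set
  StrictlyDense L R =
      (∀ r → r ∈ₜ R → ∀ u → LeafOf r u → L u)
    × (∀ a b c → L a → L b → L c → a ≢ b → a ≢ c → b ≢ c →
         (Σ Triple λ r → r ∈ₜ R × SameLeaves r a b c)
       × (∀ r s → r ∈ₜ R → s ∈ₜ R → SameLeaves r a b c → SameLeaves s a b c
            → r ≈ₜ s))

  Restrict : TripleSet → (A → Set) → TripleSet
  Restrict R L' r = R r × (∀ u → LeafOf r u → L' u)

  -- Rooted trees with labelled leaves.  Vertices of a tree T are its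
  -- subtrees (with pairwise distinct leaf labels, distinct positions give
  -- distinct subtrees).

  data Tree : Set where
    leaf : A → Tree
    node : List Tree → Tree

  mutual
    leaves : Tree → List A
    leaves (leaf a)  = [ a ]
    leaves (node cs) = leavesL cs

    leavesL : List Tree → List A
    leavesL []       = []
    leavesL (c ∷ cs) = leaves c ++ leavesL cs

  data _≼_ : Tree → Tree → Set where
    here  : ∀ {t} → t ≼ t
    there : ∀ {s c cs} → s ≼ c → c ∈ cs → s ≼ node cs

  -- Every inner vertex has outdegree ≥ 2 (no outdegree one, and no
  -- unlabelled childless vertex).
  data NoUnary : Tree → Set where
    leaf-ok : ∀ {a} → NoUnary (leaf a)
    node-ok : ∀ {cs} → 2 ≤ length cs → All NoUnary cs → NoUnary (node cs)

  PhyloTreeOn : (A → Set) → Tree → Set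
  PhyloTreeOn L T = NoUnary T × Unique (leaves T)
                  × (∀ u → (u ∈ leaves T) ⇔ L u)

  IsLca : Tree → (A → Set) → Tree → Set
  IsLca T X v = v ≼ T × (∀ u → X u → u ∈ leaves v)
              × (∀ w → w ≼ T → (∀ u → X u → u ∈ leaves w) → v ≼ w)

  Displays : Tree → Triple → Set
  Displays T r = Σ Tree λ u → Σ Tree λ v →
      IsLca T (λ w → w ≡ x r ⊎ w ≡ y r) u
    × IsLca T (LeafOf r) v
    × u ≼ v × u ≢ v

  Closure : TripleSet → TripleSet
  Closure R r = ∀ T → PhyloTreeOn (LeavesOf R) T
              → (∀ s → s ∈ₜ R → Displays T s) → Displays T r

-- For the closure condition, note that a tree displaying R'
-- displays every triple of cl(R') on its own leaves, so a triple of cl(R') with a leaf outside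
-- L_{R'} forces cl(R') to be the set of all triples; by the hypothesis on R, R would then
-- contain both (xy|z) and (yz|x), contradicting strict density. Hence x, which lies outside
-- L_{R'}, is not a leaf of any triple of cl(R') ⊆ R.
module Submission where

open import Defs
open import Data.List using (List; _∷_)
open import Data.List.Membership.Propositional using (_∈_)
open import Data.List.Membership.Propositional.Properties using (∈-++⁺ˡ; ∈-++⁺ʳ)
open import Data.List.Relation.Unary.Any using (here; there)
open import Data.Product using (_×_; _,_; Σ; proj₁; proj₂)
open import Data.Sum using (inj₁; inj₂)
open import Data.Empty using (⊥-elim)
open import Relation.Nullary using (¬_)
open import Relation.Binary.PropositionalEquality using (_≢_; refl; sym; trans)
open import Function.Bundles using (mk⇔; Equivalence)

module _ {A : Set} where

  ≈ₜ-refl : (r : Triple {A}) → r ≈ₜ r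
  ≈ₜ-refl r = inj₁ (refl , refl) , refl

  ≈ₜ-sym : (r s : Triple {A}) → r ≈ₜ s → s ≈ₜ r
  ≈ₜ-sym r s (inj₁ (p , q) , w) = inj₁ (sym p , sym q) , sym w
  ≈ₜ-sym r s (inj₂ (p , q) , w) = inj₂ (sym q , sym p) , sym w

  LeafOf-resp-≈ₜ : (r s : Triple {A}) → r ≈ₜ s → ∀ u → LeafOf r u → LeafOf s u
  LeafOf-resp-≈ₜ r s (inj₁ (p , q) , w) u (inj₁ e)        = inj₁ (trans e p)
  LeafOf-resp-≈ₜ r s (inj₁ (p , q) , w) u (inj₂ (inj₁ e)) = inj₂ (inj₁ (trans e q))
  LeafOf-resp-≈ₜ r s (inj₂ (p , q) , w) u (inj₁ e)        = inj₂ (inj₁ (trans e p))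
  LeafOf-resp-≈ₜ r s (inj₂ (p , q) , w) u (inj₂ (inj₁ e)) = inj₁ (trans e q)
  LeafOf-resp-≈ₜ r s (_ , w)            u (inj₂ (inj₂ e)) = inj₂ (inj₂ (trans e w))

  StrictlyDense-LeafOf : {L : A → Set} {R : TripleSet} → StrictlyDense L R →
    ∀ r → r ∈ₜ R → ∀ u → LeafOf r u → L u
  StrictlyDense-LeafOf (leaves-in , _) = leaves-in

  ∈ₜ-Restrict : {R : TripleSet} {L' : A → Set} →
    ∀ r → r ∈ₜ R → (∀ u → LeafOf r u → L' u) → r ∈ₜ Restrict R L'
  ∈ₜ-Restrict r (s , Rs , r≈s) r⊆L' =
    s , (Rs , λ u u∈s → r⊆L' u (LeafOf-resp-≈ₜ s r (≈ₜ-sym r s r≈s) u u∈s)) , r≈s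

  Restrict-⊆ₜ : (R : TripleSet {A}) (L' : A → Set) → Restrict R L' ⊆ₜ R
  Restrict-⊆ₜ R L' r (s , (Rs , _) , r≈s) = s , Rs , r≈s

  Restrict-LeafOf : {R : TripleSet} {L' : A → Set} →
    ∀ r → r ∈ₜ Restrict R L' → ∀ u → LeafOf r u → L' u
  Restrict-LeafOf r (s , (_ , s⊆L') , r≈s) u u∈r = s⊆L' u (LeafOf-resp-≈ₜ r s r≈s u u∈r)

  Restrict-StrictlyDense : {L L' : A → Set} {R : TripleSet} →
    StrictlyDense L R → (∀ {u} → L' u → L u) → StrictlyDense L' (Restrict R L')
  Restrict-StrictlyDense {L' = L'} {R} (_ , dense) L'⊆L = Restrict-LeafOf , restricted
    where
    restricted : ∀ a b c → L' a → L' b → L' c → a ≢ b → a ≢ c → b ≢ c →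
        (Σ Triple λ r → r ∈ₜ Restrict R L' × SameLeaves r a b c)
      × (∀ r s → r ∈ₜ Restrict R L' → s ∈ₜ Restrict R L' →
           SameLeaves r a b c → SameLeaves s a b c → r ≈ₜ s)
    restricted a b c a∈ b∈ c∈ a≢b a≢c b≢c
      with dense a b c (L'⊆L a∈) (L'⊆L b∈) (L'⊆L c∈) a≢b a≢c b≢c
    ... | (r , r∈R , r~abc) , unique = (r , ∈ₜ-Restrict r r∈R r⊆L' , r~abc) , unique-restricted
      where
      r⊆L' : ∀ u → LeafOf r u → L' u
      r⊆L' u u∈r with Equivalence.to (r~abc u) u∈r
      ... | inj₁ refl        = a∈
      ... | inj₂ (inj₁ refl) = b∈
      ... | inj₂ (inj₂ refl) = c∈

      unique-restricted : ∀ r s → r ∈ₜ Restrict R L' → s ∈ₜ Restrict R L' →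
        SameLeaves r a b c → SameLeaves s a b c → r ≈ₜ s
      unique-restricted r s r∈ s∈ = unique r s (Restrict-⊆ₜ R L' r r∈) (Restrict-⊆ₜ R L' s s∈)

  rotate : Triple {A} → Triple {A}
  rotate r = mkTriple (y r) (z r) (x r) (y≢z r) (λ e → x≢y r (sym e)) (λ e → x≢z r (sym e))

  rotate-∉ : {L : A → Set} {R : TripleSet} → StrictlyDense L R →
    ∀ r → r ∈ₜ R → ¬ (rotate r ∈ₜ R)
  rotate-∉ {L} d@(_ , dense) r r∈R rot∈R = x≢z r (sym (proj₂ r≈rot))
    where
    in-L : ∀ {u} → LeafOf r u → L u
    in-L = StrictlyDense-LeafOf d r r∈R _

    r~r : SameLeaves r (x r) (y r) (z r)
    r~r _ = mk⇔ (λ p → p) (λ p → p)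

    rot~r : SameLeaves (rotate r) (x r) (y r) (z r)
    rot~r _ = mk⇔ (λ { (inj₁ e) → inj₂ (inj₁ e) ; (inj₂ (inj₁ e)) → inj₂ (inj₂ e) ; (inj₂ (inj₂ e)) → inj₁ e })
                  (λ { (inj₁ e) → inj₂ (inj₂ e) ; (inj₂ (inj₁ e)) → inj₁ e ; (inj₂ (inj₂ e)) → inj₂ (inj₁ e) })

    r≈rot : r ≈ₜ rotate r
    r≈rot = proj₂ (dense (x r) (y r) (z r) (in-L (inj₁ refl)) (in-L (inj₂ (inj₁ refl)))
                         (in-L (inj₂ (inj₂ refl))) (x≢y r) (x≢z r) (y≢z r))
                  r (rotate r) r∈R rot∈R r~r rot~r

  mutual
    ≼-leaves : {s t : Tree {A}} → s ≼ t → ∀ {u} → u ∈ leaves s → u ∈ leaves t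
    ≼-leaves here           u∈s = u∈s
    ≼-leaves (there s≼c c∈) u∈s = child-leaves c∈ (≼-leaves s≼c u∈s)

    child-leaves : {c : Tree {A}} {cs : List Tree} → c ∈ cs → ∀ {u} → u ∈ leaves c → u ∈ leavesL cs
    child-leaves (here refl)                 u∈c = ∈-++⁺ˡ u∈c
    child-leaves {cs = c ∷ _} (there c∈) u∈c = ∈-++⁺ʳ (leaves c) (child-leaves c∈ u∈c)

  Displays-LeafOf : {L : A → Set} {T : Tree} → PhyloTreeOn L T →
    ∀ r → Displays T r → ∀ u → LeafOf r u → L u
  Displays-LeafOf (_ , _ , leaves⇔L) r (_ , v , _ , (v≼T , r⊆v , _) , _) u u∈r =
    Equivalence.to (leaves⇔L u) (≼-leaves v≼T (r⊆v u u∈r))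

  -- No tree on L_{R'} can display such a triple, so the intersection defining cl(R') is empty.
  Closure-full : {R' : TripleSet} →
    ∀ r → Closure R' r → ∀ u → LeafOf r u → ¬ LeavesOf R' u → ∀ q → Closure R' q
  Closure-full r r∈cl u u∈r u∉R' q T tree displaysR' =
    ⊥-elim (u∉R' (Displays-LeafOf tree r (r∈cl T tree displaysR') u u∈r))

  PairClosed : TripleSet {A} → Set₁
  PairClosed R = ∀ R' → R' ⊆ₜ R → HasTwoElements R' → Closure R' ⊆ₜ R

  Closure-LeafOf : {L : A → Set} {R R' : TripleSet} → StrictlyDense L R → PairClosed R →
    R' ⊆ₜ R → HasTwoElements R' →
    ∀ r → r ∈ₜ Closure R' → ∀ u → LeafOf r u → ¬ ¬ LeavesOf R' u
  Closure-LeafOf {R = R} dense closed R'⊆R two r (s , s∈cl , r≈s) u u∈r u∉R' =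
    rotate-∉ dense s (in-R s) (in-R (rotate s))
    where
    in-R : ∀ q → q ∈ₜ R
    in-R q = closed _ R'⊆R two q
               (q , Closure-full s s∈cl u (LeafOf-resp-≈ₜ r s r≈s u u∈r) u∉R' q , ≈ₜ-refl q)

lemma5 : {A : Set} (L : List A) (R : TripleSet {A})
    → StrictlyDense (λ u → u ∈ L) R
    → (∀ R' → R' ⊆ₜ R → HasTwoElements R' → Closure R' ⊆ₜ R)
    → (x : A) → x ∈ L
    → StrictlyDense (λ u → u ∈ L × u ≢ x) (Restrict R (λ u → u ∈ L × u ≢ x))
    × (∀ R' → R' ⊆ₜ Restrict R (λ u → u ∈ L × u ≢ x) → HasTwoElements R'
    → Closure R' ⊆ₜ Restrict R (λ u → u ∈ L × u ≢ x))
lemma5 {A} L R dense closed x _ = Restrict-StrictlyDense dense proj₁ , restricted-closed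
  where
  L' : A → Set
  L' u = u ∈ L × u ≢ x

  restricted-closed : PairClosed (Restrict R L')
  restricted-closed R' R'⊆R|L' two r r∈cl = ∈ₜ-Restrict r r∈R r⊆L'
    where
    R'⊆R : R' ⊆ₜ R
    R'⊆R q q∈R' = Restrict-⊆ₜ R L' q (R'⊆R|L' q q∈R')

    r∈R : r ∈ₜ R
    r∈R = closed R' R'⊆R two r r∈cl

    x∉R' : ¬ LeavesOf R' x
    x∉R' (q , q∈R' , x∈q) = proj₂ (Restrict-LeafOf q (R'⊆R|L' q q∈R') x x∈q) refl

    r⊆L' : ∀ u → LeafOf r u → L' u
    r⊆L' u u∈r = StrictlyDense-LeafOf dense r r∈R u u∈r
               , λ { refl → Closure-LeafOf dense closed R'⊆R two r r∈cl u u∈r x∉R' }
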